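{- Let $\hat\varphi$ be a formula whose free variables are among $z,x_1,\dots,x_\ell,X_1,\dots,X_p$ and which is bounded by $z$. Then $\hat\varphi$ $z$-represents a finite-state synchronous function $F:(\{0,1\}^\ell\times\{0,1\}^p)^\omega\to\{0,1\}^\omega$ induced by a deterministic Mealy machine computable from $\hat\varphi$; that is, for all $n\in\mathbb N$, all $\vec\sigma\in(\{0,1\}^\omega)^p$ and all $\vec k\in\mathbb N^\ell$ with $k_i\leq n$ for all $i$, $F(\vec k,\vec\sigma)(n)=1$ iff $\mathfrak N\models\hat\varphi[n/z,\vec k/\vec x,\vec\sigma/\vec X]$.
   Context: \emph{Language.} Two-sorted: individual variables, predicate variables. Atoms: $x\doteq y$, $x\leq y$, $\mathsf S(x,y)$, $\mathsf{Zero}(x)$, $x\in X$, $\top,\bot$. Formulae $\varphi::=\alpha\mid\varphi\wedge\psi\mid\lnot\varphi\mid\exists x\varphi\mid\exists X\varphi$. Standard model $\mathfrak N$: individuals in $\mathbb N$, predicates subsets of $\mathbb N$, $\mathsf S$ is successor, $\mathsf{Zero}(x)$ iff $x=0$. Relativization: $\alpha|\theta[y]:=\alpha$, commuting with $\wedge,\lnot,\exists X$, and $(\exists x\varphi)|\theta[y]:=\exists x(\theta[x/y]\wedge\varphi|\theta[y])$; a formula is bounded by $z$ if it has the form $\psi|(y\leq z)[y]$. A natural number $k$ is identified with the stream in $\{0,1\}^\omega$ which is $1$ exactly at position $k$; tuples of streams are identified with streams over product alphabets. Deterministic Mealy machines $(Q,q_0,\partial:Q\times\Sigma\to Q\times\Gamma)$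 induce functions $\Sigma^\omega\to\Gamma^\omega$ whose $n$-th output is the output of $\partial$ on the $n$-th input letter from the state reached after the first $n$ letters; these are the finite-state synchronous functions. -}

module Defs where

open import Data.Nat using (ℕ; zero; suc; _≤_; _≟_)
open import Data.Bool using (Bool; true; false; if_then_else_)
open import Data.Fin using (Fin)
open import Data.Vec using (Vec; lookup; map)
open import Data.Product using (Σ; _×_; _,_; proj₁; proj₂)
open import Data.Empty using (⊥)
open import Data.Unit using (⊤)
open import Relation.Nullary using (¬_; yes; no)
open import Relation.Binary.PropositionalEquality using (_≡_; _≢_)

-- Syntax.  Individual variables and predicate variables are both named
-- by natural numbers (two disjoint sorts of names).

IVar : Set
IVar = ℕ

PVar : Set
PVar = ℕ

data Atom : Set where
  eqA   : IVar → IVar → Atom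
  leA   : IVar → IVar → Atom
  succA : IVar → IVar → Atom
  zeroA : IVar → Atom
  memA  : IVar → PVar → Atom
  topA  : Atom
  botA  : Atom

data Formula : Set where
  atom : Atom → Formula
  _∧_  : Formula → Formula → Formula
  ¬f_  : Formula → Formula
  ∃i   : IVar → Formula → Formula
  ∃p   : PVar → Formula → Formula

data IOccAtom (v : IVar) : Atom → Set where
  eqˡ   : ∀ {y} → IOccAtom v (eqA v y)
  eqʳ   : ∀ {x} → IOccAtom v (eqA x v)
  leˡ   : ∀ {y} → IOccAtom v (leA v y)
  leʳ   : ∀ {x} → IOccAtom v (leA x v)
  succˡ : ∀ {y} → IOccAtom v (succA v y)
  succʳ : ∀ {x} → IOccAtom v (succA x v)
  zero∙ : IOccAtom v (zeroA v)
  mem∙  : ∀ {X} → IOccAtom v (memA v X)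

data FreeI (v : IVar) : Formula → Set where
  atom : ∀ {a} → IOccAtom v a → FreeI v (atom a)
  ∧ˡ   : ∀ {φ ψ} → FreeI v φ → FreeI v (φ ∧ ψ)
  ∧ʳ   : ∀ {φ ψ} → FreeI v ψ → FreeI v (φ ∧ ψ)
  ¬∙   : ∀ {φ} → FreeI v φ → FreeI v (¬f φ)
  ∃i∙  : ∀ {x φ} → v ≢ x → FreeI v φ → FreeI v (∃i x φ)
  ∃p∙  : ∀ {X φ} → FreeI v φ → FreeI v (∃p X φ)

data FreeP (V : PVar) : Formula → Set where
  atom : ∀ {x} → FreeP V (atom (memA x V))
  ∧ˡ   : ∀ {φ ψ} → FreeP V φ → FreeP V (φ ∧ ψ)
  ∧ʳ   : ∀ {φ ψ} → FreeP V ψ → FreeP V (φ ∧ ψ)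
  ¬∙   : ∀ {φ} → FreeP V φ → FreeP V (¬f φ)
  ∃i∙  : ∀ {x φ} → FreeP V φ → FreeP V (∃i x φ)
  ∃p∙  : ∀ {X φ} → V ≢ X → FreeP V φ → FreeP V (∃p X φ)

data BindsI (v : IVar) : Formula → Set where
  ∧ˡ   : ∀ {φ ψ} → BindsI v φ → BindsI v (φ ∧ ψ)
  ∧ʳ   : ∀ {φ ψ} → BindsI v ψ → BindsI v (φ ∧ ψ)
  ¬∙   : ∀ {φ} → BindsI v φ → BindsI v (¬f φ)
  here : ∀ {φ} → BindsI v (∃i v φ)
  ∃i∙  : ∀ {x φ} → BindsI v φ → BindsI v (∃i x φ)
  ∃p∙  : ∀ {X φ} → BindsI v φ → BindsI v (∃p X φ)

renI : IVar → IVar → IVar → IVar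
renI x y v with v ≟ y
... | yes _ = x
... | no  _ = v

substAtom : Atom → IVar → IVar → Atom
substAtom (eqA a b)   x y = eqA (renI x y a) (renI x y b)
substAtom (leA a b)   x y = leA (renI x y a) (renI x y b)
substAtom (succA a b) x y = succA (renI x y a) (renI x y b)
substAtom (zeroA a)   x y = zeroA (renI x y a)
substAtom (memA a X)  x y = memA (renI x y a) X
substAtom topA        x y = topA
substAtom botA        x y = botA

relativize : Formula → Atom → IVar → Formula
relativize (atom a)  θ y = atom a
relativize (φ ∧ ψ)   θ y = relativize φ θ y ∧ relativize ψ θ y
relativize (¬f φ)    θ y = ¬f (relativize φ θ y)
relativize (∃i x φ)  θ y = ∃i x (atom (substAtom θ x y) ∧ relativize φ θ y)
relativize (∃p X φ)  θ y = ∃p X (relativize φ θ y)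

BoundedBy : IVar → Formula → Set
BoundedBy z φ =
  Σ IVar λ y → y ≢ z × Σ Formula λ ψ → ¬ BindsI z ψ × (φ ≡ relativize ψ (leA y z) y)

-- Semantics in the standard model 𝔑.  Subsets of ℕ are streams ℕ → Bool.

Stream : Set → Set
Stream A = ℕ → A

IEnv : Set
IEnv = IVar → ℕ

PEnv : Set
PEnv = PVar → Stream Bool

updI : IEnv → IVar → ℕ → IEnv
updI ι x n v with v ≟ x
... | yes _ = n
... | no  _ = ι v

updP : PEnv → PVar → Stream Bool → PEnv
updP ρ X S V with V ≟ X
... | yes _ = S
... | no  _ = ρ V

SatAtom : IEnv → PEnv → Atom → Set
SatAtom ι ρ (eqA x y)   = ι x ≡ ι y
SatAtom ι ρ (leA x y)   = ι x ≤ ι y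
SatAtom ι ρ (succA x y) = ι y ≡ suc (ι x)
SatAtom ι ρ (zeroA x)   = ι x ≡ 0
SatAtom ι ρ (memA x X)  = ρ X (ι x) ≡ true
SatAtom ι ρ topA        = ⊤
SatAtom ι ρ botA        = ⊥

Sat : IEnv → PEnv → Formula → Set
Sat ι ρ (atom a)  = SatAtom ι ρ a
Sat ι ρ (φ ∧ ψ)   = Sat ι ρ φ × Sat ι ρ ψ
Sat ι ρ (¬f φ)    = ¬ Sat ι ρ φ
Sat ι ρ (∃i x φ)  = Σ ℕ λ n → Sat (updI ι x n) ρ φ
Sat ι ρ (∃p X φ)  = Σ (Stream Bool) λ S → Sat ι (updP ρ X S) φ

record Mealy (I O : Set) : Set where
  field
    states : ℕ
    q₀     : Fin states
    ∂      : Fin states → I → Fin states × O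

open Mealy public

stateAfter : ∀ {I O} (M : Mealy I O) → Stream I → ℕ → Fin (states M)
stateAfter M w zero    = q₀ M
stateAfter M w (suc n) = proj₁ (∂ M (stateAfter M w n) (w n))

run : ∀ {I O} → Mealy I O → Stream I → Stream O
run M w n = proj₂ (∂ M (stateAfter M w n) (w n))

-- Encodings: k ∈ ℕ as the stream that is 1 exactly at position k;
-- tuples of streams as streams over product alphabets.

natStream : ℕ → Stream Bool
natStream k j with j ≟ k
... | yes _ = true
... | no  _ = false

encode : ∀ {ℓ p} → Vec ℕ ℓ → Vec (Stream Bool) p → Stream (Vec Bool ℓ × Vec Bool p)
encode ks σs j = map (λ k → natStream k j) ks , map (λ s → s j) σs

-- Encode an assignment as a word whose letter j carries the bit [ x = j ] for each individual
-- variable x and the bit [ j ∈ X ] for each predicate variable X.  By induction on ψ there is a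
-- DFA that, after reading the first n + 1 letters, accepts iff ψ holds with all individual
-- quantifiers ranging over 0 … n: atoms are checked by a two-bit latch, ∧ and ¬ by product
-- and complement, and ∃X, ∃x by the subset construction guessing the missing bit track (for ∃x,
-- a track with a single 1).  A formula bounded by z is such a ψ read at n = z.  The Mealy
-- machine simulates the DFA on the input in which z is not yet marked and, at position n,
-- outputs the verdict the DFA would give if z were marked there.

module Submission where

open import Defs
open import Data.Nat using (ℕ; zero; suc; _≤_; _<_; _≟_; s≤s; s≤s⁻¹; _*_)
open import Data.Nat.Properties
  using (≟-diag; ≤-refl; m≤n⇒m≤1+n; m<n⇒m<1+n; <⇒≤; <⇒≢; ≤-reflexive; suc-injective; m≤n⇒m<n∨m≡n; m<1+n⇒m<n∨m≡n)
open import Data.Bool using (Bool; true; false; not; T; T?; if_then_else_; _∨_) renaming (_∧_ to _&&_)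
open import Data.Bool.Properties using (T-∧; T-∨; T-≡)
open import Data.Fin using (Fin; combine; remQuot) renaming (zero to fzero; suc to fsuc)
import Data.Fin as Fin
open import Data.Fin.Properties using (remQuot-combine; any?)
open import Data.Vec using (Vec; []; _∷_; lookup; tabulate; map)
open import Data.Vec.Properties using (lookup∘tabulate; lookup-map)
open import Data.Product using (Σ; ∃; ∃-syntax; _×_; _,_; proj₁; proj₂; map₂; uncurry)
import Data.Product as Prod
open import Data.Product.Function.NonDependent.Propositional using (_×-⇔_)
open import Data.Sum using (_⊎_; inj₁; inj₂; [_,_])
import Data.Sum as Sum
open import Data.Sum.Function.Propositional using (_⊎-⇔_)
open import Data.Vec.Membership.Propositional using (_∈_)
open import Data.Vec.Relation.Unary.Any using (here; there)
import Data.Vec.Relation.Unary.Any as Any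
open import Data.Vec.Relation.Unary.Any.Properties using (lookup-index)
open import Data.Empty using (⊥-elim)
open import Data.Unit using (⊤; tt)
open import Function using (_∘_; id)
open import Function.Bundles using (_⇔_; mk⇔; Equivalence)
open import Function.Construct.Composition using (_⇔-∘_)
open import Function.Construct.Symmetry using (⇔-sym)
open import Function.Related.TypeIsomorphisms using (¬-cong-⇔)
open import Relation.Nullary using (¬_; Dec; yes; no; map′; contradiction; _×-dec_)
open import Relation.Nullary.Decidable using (dec-no; isYes; toWitness; fromWitness)
open import Relation.Unary using (Decidable)
open import Relation.Binary using (DecidableEquality)
open import Relation.Binary.PropositionalEquality
  using (_≡_; _≢_; refl; sym; trans; cong; cong₂; subst)

open Equivalence using (to; from)

_[_≔_] : {A : Set} → (ℕ → A) → ℕ → A → ℕ → A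
(f [ x ≔ a ]) v with v ≟ x
... | yes _ = a
... | no  _ = f v

[≔]-≡ : {A : Set} (f : ℕ → A) (x : ℕ) (a : A) → (f [ x ≔ a ]) x ≡ a
[≔]-≡ f x a rewrite ≟-diag {x} refl = refl

[≔]-≢ : {A : Set} (f : ℕ → A) {x v : ℕ} (a : A) → v ≢ x → (f [ x ≔ a ]) v ≡ f v
[≔]-≢ f {x} {v} a v≢x rewrite dec-no (v ≟ x) v≢x = refl

updI-≡ : ∀ ι x n → updI ι x n x ≡ n
updI-≡ ι x n rewrite ≟-diag {x} refl = refl

updI-≢ : ∀ ι {x v} n → v ≢ x → updI ι x n v ≡ ι v
updI-≢ ι {x} {v} n v≢x rewrite dec-no (v ≟ x) v≢x = refl

updP-≡ : ∀ ρ X S → updP ρ X S X ≡ S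
updP-≡ ρ X S rewrite ≟-diag {X} refl = refl

updP-≢ : ∀ ρ {X V} S → V ≢ X → updP ρ X S V ≡ ρ V
updP-≢ ρ {X} {V} S V≢X rewrite dec-no (V ≟ X) V≢X = refl

natStream-≡ : ∀ k → natStream k k ≡ true
natStream-≡ k rewrite ≟-diag {k} refl = refl

natStream-≢ : ∀ {k j} → j ≢ k → natStream k j ≡ false
natStream-≢ {k} {j} j≢k rewrite dec-no (j ≟ k) j≢k = refl

T-natStream : ∀ {k j} → T (natStream k j) ⇔ j ≡ k
T-natStream {k} {j} with j ≟ k
... | yes j≡k = mk⇔ (λ _ → j≡k) _
... | no  j≢k = mk⇔ (λ ()) j≢k

T-not : ∀ {b} → T (not b) ⇔ (¬ T b)
T-not {true}  = mk⇔ (λ ()) (λ ¬t → ¬t tt)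
T-not {false} = mk⇔ (λ _ ()) _

T-cong : ∀ {b c} → b ≡ c → T b ⇔ T c
T-cong refl = mk⇔ id id

<-suc-⇔ : ∀ {m n} → (m < n ⊎ n ≡ m) ⇔ m < suc n
<-suc-⇔ = mk⇔ [ m<n⇒m<1+n , (λ { refl → ≤-refl }) ]
              (Sum.map₂ sym ∘ m<1+n⇒m<n∨m≡n)

∃-cong-⇔ : {A : Set} {P Q : A → Set} → (∀ a → P a ⇔ Q a) → (∃ P ⇔ ∃ Q)
∃-cong-⇔ P⇔Q = mk⇔ (map₂ (to (P⇔Q _))) (map₂ (from (P⇔Q _)))

-- Finite types

record Finite (A : Set) : Set where
  field
    size          : ℕ
    toFin         : A → Fin size
    fromFin       : Fin size → A
    fromFin-toFin : ∀ a → fromFin (toFin a) ≡ a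

  infix 4 _≡?_ _∈ₛ_ _∈ₛ?_

  _≡?_ : DecidableEquality A
  a ≡? b = map′ injective (cong toFin) (toFin a Fin.≟ toFin b)
    where
    injective : toFin a ≡ toFin b → a ≡ b
    injective eq = trans (sym (fromFin-toFin a)) (trans (cong fromFin eq) (fromFin-toFin b))

  ∃? : {P : A → Set} → Decidable P → Dec (∃ P)
  ∃? {P} P? = map′ (Prod.map fromFin id) (λ (a , p) → toFin a , subst P (sym (fromFin-toFin a)) p)
                   (any? (P? ∘ fromFin))

  Subset : Set
  Subset = Vec Bool size

  _∈ₛ_ : A → Subset → Set
  a ∈ₛ S = T (lookup S (toFin a))

  _∈ₛ?_ : ∀ a S → Dec (a ∈ₛ S)
  a ∈ₛ? S = T? (lookup S (toFin a))

  subset : {P : A → Set} → Decidable P → Subset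
  subset P? = tabulate (isYes ∘ P? ∘ fromFin)

  ∈-subset : {P : A → Set} (P? : Decidable P) {a : A} → a ∈ₛ subset P? ⇔ P a
  ∈-subset {P} P? {a} rewrite lookup∘tabulate (isYes ∘ P? ∘ fromFin) (toFin a) | fromFin-toFin a =
    mk⇔ toWitness fromWitness

open Finite using (size; toFin; fromFin; fromFin-toFin)

Bool-finite : Finite Bool
Bool-finite = record { size = 2 ; toFin = toFin′ ; fromFin = fromFin′ ; fromFin-toFin = inverse }
  where
  toFin′ : Bool → Fin 2
  toFin′ false = fzero
  toFin′ true  = fsuc fzero
  fromFin′ : Fin 2 → Bool
  fromFin′ fzero    = false
  fromFin′ (fsuc _) = true
  inverse : ∀ b → fromFin′ (toFin′ b) ≡ b
  inverse false = refl
  inverse true  = refl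

⊤-finite : Finite ⊤
⊤-finite = record { size = 1 ; toFin = λ _ → fzero ; fromFin = λ _ → tt ; fromFin-toFin = λ _ → refl }

×-finite : {A B : Set} → Finite A → Finite B → Finite (A × B)
×-finite {A} {B} FA FB = record
  { size = size FA * size FB
  ; toFin = λ (a , b) → combine (toFin FA a) (toFin FB b)
  ; fromFin = fromFin′
  ; fromFin-toFin = inverse
  }
  where
  fromFin′ : Fin (size FA * size FB) → A × B
  fromFin′ = Prod.map (fromFin FA) (fromFin FB) ∘ remQuot (size FB)
  inverse : ∀ ab → fromFin′ (combine (toFin FA (proj₁ ab)) (toFin FB (proj₂ ab))) ≡ ab
  inverse (a , b) = trans (cong (Prod.map (fromFin FA) (fromFin FB)) (remQuot-combine (toFin FA a) (toFin FB b)))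
                          (cong₂ _,_ (fromFin-toFin FA a) (fromFin-toFin FB b))

Vec-finite : {A : Set} → Finite A → ∀ n → Finite (Vec A n)
Vec-finite FA zero = record { size = 1 ; toFin = λ _ → fzero ; fromFin = λ _ → [] ; fromFin-toFin = λ { [] → refl } }
Vec-finite FA (suc n) = record
  { size = size F×
  ; toFin = λ { (a ∷ as) → toFin F× (a , as) }
  ; fromFin = uncurry _∷_ ∘ fromFin F×
  ; fromFin-toFin = λ { (a ∷ as) → cong (uncurry _∷_) (fromFin-toFin F× (a , as)) }
  }
  where F× = ×-finite FA (Vec-finite FA n)

Subset-finite : {A : Set} (F : Finite A) → Finite (Finite.Subset F)
Subset-finite F = Vec-finite Bool-finite (size F)

-- Automata

trace : {S Σ : Set} → (S → Σ → S) → S → Stream Σ → ℕ → S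
trace δ q w zero    = q
trace δ q w (suc j) = δ (trace δ q w j) (w j)

trace-prefix : {S Σ : Set} (δ : S → Σ → S) (q : S) {w w′ : Stream Σ} →
               ∀ j → (∀ {i} → i < j → w i ≡ w′ i) → trace δ q w j ≡ trace δ q w′ j
trace-prefix δ q zero    agree = refl
trace-prefix δ q (suc j) agree =
  cong₂ δ (trace-prefix δ q j (agree ∘ m<n⇒m<1+n)) (agree ≤-refl)

record DFA (Σ : Set) : Set₁ where
  field
    State     : Set
    finite    : Finite State
    start     : State
    step      : State → Σ → State
    accepting : State → Bool

  reach : Stream Σ → ℕ → State
  reach = trace step start

  reach-prefix : ∀ {w w′} j → (∀ {i} → i < j → w i ≡ w′ i) → reach w j ≡ reach w′ j
  reach-prefix = trace-prefix step start

open DFA using (State; finite; start; step; accepting; reach)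

Accepts : {Σ : Set} → DFA Σ → Stream Σ → ℕ → Set
Accepts A w n = T (accepting A (reach A w (suc n)))

complement : {Σ : Set} → DFA Σ → DFA Σ
complement A = record A { accepting = not ∘ accepting A }

complement-accepts : {Σ : Set} (A : DFA Σ) {w : Stream Σ} {n : ℕ} → Accepts (complement A) w n ⇔ (¬ Accepts A w n)
complement-accepts A = T-not

intersection : {Σ : Set} → DFA Σ → DFA Σ → DFA Σ
intersection A B = record
  { State     = State A × State B
  ; finite    = ×-finite (finite A) (finite B)
  ; start     = start A , start B
  ; step      = λ (p , q) a → step A p a , step B q a
  ; accepting = λ (p , q) → accepting A p && accepting B q
  }

reach-intersection : {Σ : Set} (A B : DFA Σ) (w : Stream Σ) →
                     ∀ j → reach (intersection A B) w j ≡ (reach A w j , reach B w j)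
reach-intersection A B w zero    = refl
reach-intersection A B w (suc j) rewrite reach-intersection A B w j = refl

intersection-accepts : {Σ : Set} (A B : DFA Σ) {w : Stream Σ} {n : ℕ} →
                       Accepts (intersection A B) w n ⇔ (Accepts A w n × Accepts B w n)
intersection-accepts A B {w} {n} rewrite reach-intersection A B w n = T-∧

relabel : {Σ Σ′ : Set} → (Σ′ → Σ) → DFA Σ → DFA Σ′
relabel f A = record
  { State = State A ; finite = finite A ; start = start A
  ; step = λ q a → step A q (f a) ; accepting = accepting A }

reach-relabel : {Σ Σ′ : Set} (f : Σ′ → Σ) (A : DFA Σ) (w : Stream Σ′) →
                ∀ j → reach (relabel f A) w j ≡ reach A (f ∘ w) j
reach-relabel f A w zero    = refl
reach-relabel f A w (suc j) = cong (λ q → step A q (f (w j))) (reach-relabel f A w j)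

relabel-accepts : {Σ Σ′ : Set} (f : Σ′ → Σ) (A : DFA Σ) {w : Stream Σ′} {n : ℕ} →
                  Accepts (relabel f A) w n ⇔ Accepts A (f ∘ w) n
relabel-accepts f A {w} {n} rewrite reach-relabel f A w (suc n) = mk⇔ id id

infixr 5 _⊗_
_⊗_ : {A B : Set} → Stream A → Stream B → Stream (A × B)
(u ⊗ v) j = u j , v j

module _ {Σ : Set} (A : DFA (Σ × Bool)) where
  private
    module F = Finite (finite A)
    open F using (_∈ₛ_; _∈ₛ?_)

    Successor : F.Subset → Σ → State A → Set
    Successor S a q′ = ∃[ q ] q ∈ₛ S × ∃[ b ] step A q (a , b) ≡ q′

    successor? : ∀ S a → Decidable (Successor S a)
    successor? S a q′ = F.∃? λ q → q ∈ₛ? S ×-dec Finite.∃? Bool-finite (λ b → step A q (a , b) F.≡? q′)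

    Accepting : F.Subset → Set
    Accepting S = ∃[ q ] q ∈ₛ S × T (accepting A q)

    accepting? : Decidable Accepting
    accepting? S = F.∃? λ q → q ∈ₛ? S ×-dec T? (accepting A q)

  -- Subset construction: the Bool track of the input is guessed nondeterministically.
  powerset : DFA Σ
  powerset = record
    { State     = F.Subset
    ; finite    = Subset-finite (finite A)
    ; start     = F.subset (F._≡? start A)
    ; step      = λ S a → F.subset (successor? S a)
    ; accepting = isYes ∘ accepting?
    }

  ∈-reach-powerset : ∀ w j {q} → q ∈ₛ reach powerset w j ⇔ (∃[ β ] q ≡ reach A (w ⊗ β) j)
  ∈-reach-powerset w zero = mk⇔ (λ q≡ → (λ _ → false) , q≡) proj₂ ⇔-∘ F.∈-subset (F._≡? start A)
  ∈-reach-powerset w (suc j) {q} = mk⇔ extend restrict ⇔-∘ F.∈-subset (successor? (reach powerset w j) (w j))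
    where
    ih = ∈-reach-powerset w j
    extend : Successor (reach powerset w j) (w j) q → ∃[ β ] q ≡ reach A (w ⊗ β) (suc j)
    extend (q′ , q′∈ , b , q′↦q) with to ih q′∈
    ... | β , refl = β [ j ≔ b ] , sym (trans (cong₂ (step A) same-past (cong (w j ,_) ([≔]-≡ β j b))) q′↦q)
      where
      same-past : reach A (w ⊗ (β [ j ≔ b ])) j ≡ reach A (w ⊗ β) j
      same-past = DFA.reach-prefix A j (λ i<j → cong (_ ,_) ([≔]-≢ β b (<⇒≢ i<j)))
    restrict : (∃[ β ] q ≡ reach A (w ⊗ β) (suc j)) → Successor (reach powerset w j) (w j) q
    restrict (β , refl) = reach A (w ⊗ β) j , from ih (β , refl) , β j , refl

  powerset-accepts : ∀ {w n} → Accepts powerset w n ⇔ (∃[ β ] Accepts A (w ⊗ β) n)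
  powerset-accepts {w} {n} = mk⇔ pick place ⇔-∘ mk⇔ toWitness fromWitness
    where
    ih = ∈-reach-powerset w (suc n)
    pick : Accepting (reach powerset w (suc n)) → ∃[ β ] Accepts A (w ⊗ β) n
    pick (q , q∈ , acc) with to ih q∈
    ... | β , refl = β , acc
    place : (∃[ β ] Accepts A (w ⊗ β) n) → Accepting (reach powerset w (suc n))
    place (β , acc) = _ , from ih (β , refl) , acc

markedAt : {I Σ : Set} → (I → Bool → Σ) → Stream I → ℕ → Stream Σ
markedAt mark w m j = mark (w j) (natStream m j)

module _ {Σ : Set} (mark : Σ → Bool → Σ) (A : DFA Σ) where

  -- Runs A on w marked at the position of the first true guess; later guesses are ignored.
  markOnce : DFA (Σ × Bool)
  markOnce = record
    { State     = Bool × State A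
    ; finite    = ×-finite Bool-finite (finite A)
    ; start     = false , start A
    ; step      = λ (marked , q) (a , b) →
                    if marked then (true , step A q (mark a false)) else (b , step A q (mark a b))
    ; accepting = λ (marked , q) → marked && accepting A q
    }

  -- While no guess was true, A has run on w marked at any position ≥ j; position j is the convenient one.
  reach-markOnce : ∀ w β j →
      ((∀ {i} → i < j → β i ≡ false) × reach markOnce (w ⊗ β) j ≡ (false , reach A (markedAt mark w j) j))
    ⊎ (∃[ m ] m < j × β m ≡ true × reach markOnce (w ⊗ β) j ≡ (true , reach A (markedAt mark w m) j))
  reach-markOnce w β zero = inj₁ ((λ ()) , refl)
  reach-markOnce w β (suc j) with reach-markOnce w β j
  ... | inj₂ (m , m<j , βm , eq) rewrite eq =
    inj₂ (m , m<n⇒m<1+n m<j , βm ,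
          cong (λ b → true , step A (reach A (markedAt mark w m) j) (mark (w j) b)) (sym (natStream-≢ (<⇒≢ m<j ∘ sym))))
  ... | inj₁ (unmarked , eq) rewrite eq with β j in βj
  ...   | true  = inj₂ (j , ≤-refl , βj ,
                        cong (λ b → true , step A (reach A (markedAt mark w j) j) (mark (w j) b)) (sym (natStream-≡ j)))
  ...   | false = inj₁ (unmarked′ , cong₂ (λ q b → false , step A q (mark (w j) b)) same-past (sym (natStream-≢ (<⇒≢ ≤-refl))))
    where
    unmarked′ : ∀ {i} → i < suc j → β i ≡ false
    unmarked′ (s≤s i≤j) with m≤n⇒m<n∨m≡n i≤j
    ... | inj₁ i<j  = unmarked i<j
    ... | inj₂ refl = βj
    same-past : reach A (markedAt mark w j) j ≡ reach A (markedAt mark w (suc j)) j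
    same-past = DFA.reach-prefix A j λ i<j →
      cong (mark _) (trans (natStream-≢ (<⇒≢ i<j)) (sym (natStream-≢ (<⇒≢ (m<n⇒m<1+n i<j)))))

  markOnce-accepts : ∀ {w n} → (∃[ β ] Accepts markOnce (w ⊗ β) n) ⇔ (∃[ m ] m ≤ n × Accepts A (markedAt mark w m) n)
  markOnce-accepts {w} {n} = mk⇔ firstMark guess
    where
    firstMark : (∃[ β ] Accepts markOnce (w ⊗ β) n) → ∃[ m ] m ≤ n × Accepts A (markedAt mark w m) n
    firstMark (β , acc) with reach-markOnce w β (suc n)
    ... | inj₁ (_ , eq) rewrite eq = ⊥-elim acc
    ... | inj₂ (m , s≤s m≤n , _ , eq) rewrite eq = m , m≤n , acc
    guess : (∃[ m ] m ≤ n × Accepts A (markedAt mark w m) n) → ∃[ β ] Accepts markOnce (w ⊗ β) n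
    guess (m , m≤n , acc) with reach-markOnce w (natStream m) (suc n)
    ... | inj₁ (unmarked , _) = contradiction (trans (sym (natStream-≡ m)) (unmarked (s≤s m≤n))) λ ()
    ... | inj₂ (m′ , _ , β≡ , eq) with to T-natStream (subst T (sym β≡) tt)
    ...   | refl = natStream m , subst (T ∘ accepting markOnce) (sym eq) acc

-- Formulas as automata

record Letter : Set where
  field
    ind  : IVar → Bool
    pred : PVar → Bool

open Letter

setInd : IVar → Letter → Bool → Letter
setInd x a b = record a { ind = ind a [ x ≔ b ] }

setPred : PVar → Letter → Bool → Letter
setPred X a b = record a { pred = pred a [ X ≔ b ] }

record Encodes (n : ℕ) (w : Stream Letter) (ι : IEnv) (ρ : PEnv) (φ : Formula) : Set where
  field
    ind-bounded : ∀ {v} → FreeI v φ → ι v ≤ n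
    ind-marks   : ∀ {v} → FreeI v φ → ∀ {j} → j ≤ n → ind (w j) v ≡ natStream (ι v) j
    pred-marks  : ∀ {V} → FreeP V φ → ∀ {j} → j ≤ n → pred (w j) V ≡ ρ V j

open Encodes

Encodes-sub : ∀ {n w ι ρ φ ψ} → (∀ {v} → FreeI v ψ → FreeI v φ) → (∀ {V} → FreeP V ψ → FreeP V φ) →
              Encodes n w ι ρ φ → Encodes n w ι ρ ψ
Encodes-sub freeI freeP enc = record
  { ind-bounded = ind-bounded enc ∘ freeI
  ; ind-marks   = ind-marks enc ∘ freeI
  ; pred-marks  = pred-marks enc ∘ freeP
  }

Encodes-∃i : ∀ {n w ι ρ x ψ m} → Encodes n w ι ρ (∃i x ψ) → m ≤ n →
             Encodes n (markedAt (setInd x) w m) (updI ι x m) ρ ψ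
Encodes-∃i {n} {w} {ι} {x = x} {m = m} enc m≤n = record
  { ind-bounded = bounded
  ; ind-marks   = marks
  ; pred-marks  = pred-marks enc ∘ ∃i∙
  }
  where
  bounded : ∀ {v} → FreeI v _ → updI ι x m v ≤ n
  bounded {v} free = cases (v ≟ x)
    where
    cases : Dec (v ≡ x) → updI ι x m v ≤ n
    cases (yes refl) = subst (_≤ n) (sym (updI-≡ ι v m)) m≤n
    cases (no  v≢x)  = subst (_≤ n) (sym (updI-≢ ι m v≢x)) (ind-bounded enc (∃i∙ v≢x free))
  marks : ∀ {v} → FreeI v _ → ∀ {j} → j ≤ n → (ind (w j) [ x ≔ natStream m j ]) v ≡ natStream (updI ι x m v) j
  marks {v} free {j} j≤n = cases (v ≟ x)
    where
    cases : Dec (v ≡ x) → (ind (w j) [ x ≔ natStream m j ]) v ≡ natStream (updI ι x m v) j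
    cases (yes refl) = trans ([≔]-≡ _ v _) (cong (λ k → natStream k j) (sym (updI-≡ ι v m)))
    cases (no  v≢x)  = trans ([≔]-≢ _ _ v≢x)
      (trans (ind-marks enc (∃i∙ v≢x free) j≤n) (cong (λ k → natStream k j) (sym (updI-≢ ι m v≢x))))

Encodes-∃p : ∀ {n w ι ρ X ψ} → Encodes n w ι ρ (∃p X ψ) → ∀ β →
             Encodes n (uncurry (setPred X) ∘ (w ⊗ β)) ι (updP ρ X β) ψ
Encodes-∃p {n} {w} {ρ = ρ} {X} enc β = record
  { ind-bounded = ind-bounded enc ∘ ∃p∙
  ; ind-marks   = ind-marks enc ∘ ∃p∙
  ; pred-marks  = marks
  }
  where
  marks : ∀ {V} → FreeP V _ → ∀ {j} → j ≤ n → (pred (w j) [ X ≔ β j ]) V ≡ updP ρ X β V j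
  marks {V} free {j} j≤n = cases (V ≟ X)
    where
    cases : Dec (V ≡ X) → (pred (w j) [ X ≔ β j ]) V ≡ updP ρ X β V j
    cases (yes refl) = trans ([≔]-≡ _ V _) (cong (λ S → S j) (sym (updP-≡ ρ V β)))
    cases (no  V≢X)  = trans ([≔]-≢ _ _ V≢X)
      (trans (pred-marks enc (∃p∙ V≢X free) j≤n) (cong (λ S → S j) (sym (updP-≢ ρ β V≢X))))

Sat≤ : ℕ → IEnv → PEnv → Formula → Set
Sat≤ n ι ρ (atom α)  = SatAtom ι ρ α
Sat≤ n ι ρ (φ ∧ ψ)   = Sat≤ n ι ρ φ × Sat≤ n ι ρ ψ
Sat≤ n ι ρ (¬f φ)    = ¬ Sat≤ n ι ρ φ
Sat≤ n ι ρ (∃i x φ)  = ∃[ m ] m ≤ n × Sat≤ n (updI ι x m) ρ φ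
Sat≤ n ι ρ (∃p X φ)  = ∃[ S ] Sat≤ n ι (updP ρ X S) φ

Represents : DFA Letter → Formula → Set
Represents A φ = ∀ {n w ι ρ} → Encodes n w ι ρ φ → Accepts A w n ⇔ Sat≤ n ι ρ φ

∧-represents : ∀ {A B φ ψ} → Represents A φ → Represents B ψ → Represents (intersection A B) (φ ∧ ψ)
∧-represents {A} {B} repA repB {n} {w} enc =
  (repA (Encodes-sub ∧ˡ ∧ˡ enc) ×-⇔ repB (Encodes-sub ∧ʳ ∧ʳ enc)) ⇔-∘ intersection-accepts A B {w} {n}

¬-represents : ∀ {A φ} → Represents A φ → Represents (complement A) (¬f φ)
¬-represents {A} repA {n} {w} enc = ¬-cong-⇔ (repA (Encodes-sub ¬∙ ¬∙ enc)) ⇔-∘ complement-accepts A {w} {n}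

∃i-represents : ∀ {A ψ} x → Represents A ψ → Represents (powerset (markOnce (setInd x) A)) (∃i x ψ)
∃i-represents {A} x repA {n} {w} enc =
  ∃-cong-⇔ (λ _ → ∃-cong-⇔ λ m≤n → repA (Encodes-∃i enc m≤n))
    ⇔-∘ (markOnce-accepts (setInd x) A {w} {n} ⇔-∘ powerset-accepts (markOnce (setInd x) A) {w} {n})

∃p-represents : ∀ {A ψ} X → Represents A ψ → Represents (powerset (relabel (uncurry (setPred X)) A)) (∃p X ψ)
∃p-represents {A} X repA {n} {w} enc =
  ∃-cong-⇔ (λ β → repA (Encodes-∃p enc β) ⇔-∘ relabel-accepts (uncurry (setPred X)) A {w ⊗ β} {n})
    ⇔-∘ powerset-accepts (relabel (uncurry (setPred X)) A) {w} {n}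

constant : Bool → DFA Letter
constant b = record { State = ⊤ ; finite = ⊤-finite ; start = tt ; step = λ _ _ → tt ; accepting = λ _ → b }

-- g updates a memory bit at every letter; the output is h (memory, letter) at the letter marked for key.
latch : IVar → (Bool → Letter → Bool) → (Bool → Letter → Bool) → DFA Letter
latch key g h = record
  { State     = Bool × Bool
  ; finite    = ×-finite Bool-finite Bool-finite
  ; start     = false , false
  ; step      = λ (memory , out) a → g memory a , (if ind a key then h memory a else out)
  ; accepting = proj₂
  }

latch-accepts : ∀ key g h {w n k} → k ≤ n → (∀ {j} → j ≤ n → ind (w j) key ≡ natStream k j) →
                Accepts (latch key g h) w n ⇔ T (h (trace g false w k) (w k))
latch-accepts key g h {w} {n} {k} k≤n marks = T-cong (output (suc n) (s≤s k≤n) ≤-refl)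
  where
  L = latch key g h
  memory : ∀ j → proj₁ (reach L w j) ≡ trace g false w j
  memory zero    = refl
  memory (suc j) = cong (λ s → g s (w j)) (memory j)
  output : ∀ j → k < j → j ≤ suc n → proj₂ (reach L w j) ≡ h (trace g false w k) (w k)
  output (suc j) (s≤s k≤j) (s≤s j≤n) with m≤n⇒m<n∨m≡n k≤j
  ... | inj₂ refl rewrite marks j≤n | natStream-≡ j | memory j = refl
  ... | inj₁ k<j  rewrite marks j≤n | natStream-≢ (<⇒≢ k<j ∘ sym) = output j k<j (m≤n⇒m≤1+n j≤n)

atomAutomaton : Atom → DFA Letter
atomAutomaton (eqA x y)   = latch y (λ _ _ → false) (λ _ a → ind a x)
atomAutomaton (leA x y)   = latch y (λ s a → s ∨ ind a x) (λ s a → s ∨ ind a x)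
atomAutomaton (succA x y) = latch y (λ _ a → ind a x) (λ s _ → s)
atomAutomaton (zeroA x)   = latch x (λ _ _ → true) (λ s _ → not s)
atomAutomaton (memA x X)  = latch x (λ _ _ → false) (λ _ a → pred a X)
atomAutomaton topA        = constant true
atomAutomaton botA        = constant false

atom-represents : ∀ α → Represents (atomAutomaton α) (atom α)
atom-represents (eqA x y) {n} {w} enc =
  mk⇔ sym sym ⇔-∘ (T-natStream ⇔-∘ (T-cong (ind-marks enc (atom eqˡ) (ind-bounded enc (atom eqʳ)))
    ⇔-∘ latch-accepts y _ _ {w} {n} (ind-bounded enc (atom eqʳ)) (ind-marks enc (atom eqʳ))))
atom-represents (leA x y) {n} {w} {ι} enc =
  mk⇔ s≤s⁻¹ s≤s ⇔-∘ (seen (suc (ι y)) (s≤s y≤n) ⇔-∘ latch-accepts y _ _ {w} {n} y≤n (ind-marks enc (atom leʳ)))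
  where
  y≤n = ind-bounded enc (atom leʳ)
  seen : ∀ j → j ≤ suc n → T (trace (λ s a → s ∨ ind a x) false w j) ⇔ ι x < j
  seen zero    _          = mk⇔ (λ ()) (λ ())
  seen (suc j) (s≤s j≤n) =
    <-suc-⇔ ⇔-∘ ((seen j (m≤n⇒m≤1+n j≤n) ⊎-⇔ (T-natStream ⇔-∘ T-cong (ind-marks enc (atom leˡ) j≤n))) ⇔-∘ T-∨)
atom-represents (succA x y) {n} {w} {ι} enc =
  previous (ι y) y≤n ⇔-∘ latch-accepts y _ _ {w} {n} y≤n (ind-marks enc (atom succʳ))
  where
  y≤n = ind-bounded enc (atom succʳ)
  previous : ∀ k → k ≤ n → T (trace (λ _ a → ind a x) false w k) ⇔ k ≡ suc (ι x)
  previous zero    _    = mk⇔ (λ ()) (λ ())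
  previous (suc k) k<n =
    mk⇔ (cong suc) suc-injective ⇔-∘ (T-natStream ⇔-∘ T-cong (ind-marks enc (atom succˡ) (<⇒≤ k<n)))
atom-represents (zeroA x) {n} {w} {ι} enc =
  initial (ι x) ⇔-∘ latch-accepts x _ _ {w} {n} (ind-bounded enc (atom zero∙)) (ind-marks enc (atom zero∙))
  where
  initial : ∀ k → T (not (trace (λ _ _ → true) false w k)) ⇔ k ≡ 0
  initial zero    = mk⇔ (λ _ → refl) (λ _ → tt)
  initial (suc k) = mk⇔ (λ ()) (λ ())
atom-represents (memA x X) {n} {w} enc =
  T-≡ ⇔-∘ (T-cong (pred-marks enc atom x≤n) ⇔-∘ latch-accepts x _ _ {w} {n} x≤n (ind-marks enc (atom mem∙)))
  where x≤n = ind-bounded enc (atom mem∙)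
atom-represents topA enc = mk⇔ id id
atom-represents botA enc = mk⇔ id id

automaton : Formula → DFA Letter
automaton (atom α)  = atomAutomaton α
automaton (φ ∧ ψ)   = intersection (automaton φ) (automaton ψ)
automaton (¬f φ)    = complement (automaton φ)
automaton (∃i x φ)  = powerset (markOnce (setInd x) (automaton φ))
automaton (∃p X φ)  = powerset (relabel (uncurry (setPred X)) (automaton φ))

automaton-represents : ∀ φ → Represents (automaton φ) φ
automaton-represents (atom α)  = atom-represents α
automaton-represents (φ ∧ ψ)   = ∧-represents {automaton φ} {automaton ψ} (automaton-represents φ) (automaton-represents ψ)
automaton-represents (¬f φ)    = ¬-represents {automaton φ} (automaton-represents φ)
automaton-represents (∃i x φ)  = ∃i-represents {automaton φ} x (automaton-represents φ)
automaton-represents (∃p X φ)  = ∃p-represents {automaton φ} X (automaton-represents φ)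

-- Relativization

FreeI-relativize : ∀ {v} ψ θ y → FreeI v ψ → FreeI v (relativize ψ θ y)
FreeI-relativize (atom α) θ y free         = free
FreeI-relativize (φ ∧ ψ)  θ y (∧ˡ free)    = ∧ˡ (FreeI-relativize φ θ y free)
FreeI-relativize (φ ∧ ψ)  θ y (∧ʳ free)    = ∧ʳ (FreeI-relativize ψ θ y free)
FreeI-relativize (¬f φ)   θ y (¬∙ free)    = ¬∙ (FreeI-relativize φ θ y free)
FreeI-relativize (∃i x φ) θ y (∃i∙ v≢x free) = ∃i∙ v≢x (∧ʳ (FreeI-relativize φ θ y free))
FreeI-relativize (∃p X φ) θ y (∃p∙ free)   = ∃p∙ (FreeI-relativize φ θ y free)

FreeP-relativize : ∀ {V} ψ θ y → FreeP V ψ → FreeP V (relativize ψ θ y)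
FreeP-relativize (atom α) θ y free         = free
FreeP-relativize (φ ∧ ψ)  θ y (∧ˡ free)    = ∧ˡ (FreeP-relativize φ θ y free)
FreeP-relativize (φ ∧ ψ)  θ y (∧ʳ free)    = ∧ʳ (FreeP-relativize ψ θ y free)
FreeP-relativize (¬f φ)   θ y (¬∙ free)    = ¬∙ (FreeP-relativize φ θ y free)
FreeP-relativize (∃i x φ) θ y (∃i∙ free)   = ∃i∙ (∧ʳ (FreeP-relativize φ θ y free))
FreeP-relativize (∃p X φ) θ y (∃p∙ V≢X free) = ∃p∙ V≢X (FreeP-relativize φ θ y free)

renI-≡ : ∀ x y → renI x y y ≡ x
renI-≡ x y rewrite ≟-diag {y} refl = refl

renI-≢ : ∀ x {y v} → v ≢ y → renI x y v ≡ v
renI-≢ x {y} {v} v≢y rewrite dec-no (v ≟ y) v≢y = refl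

Sat-relativize : ∀ {y z} → y ≢ z → ∀ ψ → ¬ BindsI z ψ → ∀ ι ρ →
                 Sat ι ρ (relativize ψ (leA y z) y) ⇔ Sat≤ (ι z) ι ρ ψ
Sat-relativize y≢z (atom α) z-free ι ρ = mk⇔ id id
Sat-relativize y≢z (φ ∧ ψ)  z-free ι ρ =
  Sat-relativize y≢z φ (z-free ∘ ∧ˡ) ι ρ ×-⇔ Sat-relativize y≢z ψ (z-free ∘ ∧ʳ) ι ρ
Sat-relativize y≢z (¬f φ)   z-free ι ρ = ¬-cong-⇔ (Sat-relativize y≢z φ (z-free ∘ ¬∙) ι ρ)
Sat-relativize {y} {z} y≢z (∃i x φ) z-free ι ρ rewrite renI-≡ x y | renI-≢ x (y≢z ∘ sym) =
  ∃-cong-⇔ λ m → bound m ×-⇔ body m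
  where
  z≢x : z ≢ x
  z≢x refl = z-free here
  z-unchanged : ∀ m → updI ι x m z ≡ ι z
  z-unchanged m = updI-≢ ι m z≢x
  bound : ∀ m → (updI ι x m x ≤ updI ι x m z) ⇔ (m ≤ ι z)
  bound m rewrite updI-≡ ι x m | z-unchanged m = mk⇔ id id
  body : ∀ m → Sat (updI ι x m) ρ (relativize φ (leA y z) y) ⇔ Sat≤ (ι z) (updI ι x m) ρ φ
  body m = subst (λ k → Sat (updI ι x m) ρ (relativize φ (leA y z) y) ⇔ Sat≤ k (updI ι x m) ρ φ)
                 (z-unchanged m) (Sat-relativize y≢z φ (z-free ∘ ∃i∙) (updI ι x m) ρ)
Sat-relativize y≢z (∃p X φ) z-free ι ρ =
  ∃-cong-⇔ λ S → Sat-relativize y≢z φ (z-free ∘ ∃p∙) ι (updP ρ X S)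

-- The Mealy machine

mealy : {I Σ : Set} → (I → Bool → Σ) → DFA Σ → Mealy I Bool
mealy mark A = record
  { states = size (finite A)
  ; q₀     = toFin (finite A) (start A)
  ; ∂      = λ i a → toFin (finite A) (step A (fromFin (finite A) i) (mark a false))
                   , accepting A (step A (fromFin (finite A) i) (mark a true))
  }

run-mealy : {I Σ : Set} (mark : I → Bool → Σ) (A : DFA Σ) (u : Stream I) (n : ℕ) →
            run (mealy mark A) u n ≡ accepting A (reach A (markedAt mark u n) (suc n))
run-mealy mark A u n =
  cong₂ (λ q b → accepting A (step A q (mark (u n) b))) (trans (decoded n) unmarked-past) (sym (natStream-≡ n))
  where
  M = mealy mark A
  decoded : ∀ j → fromFin (finite A) (stateAfter M u j) ≡ reach A (λ i → mark (u i) false) j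
  decoded zero    = fromFin-toFin (finite A) (start A)
  decoded (suc j) = trans (fromFin-toFin (finite A) _) (cong (λ q → step A q (mark (u j) false)) (decoded j))
  unmarked-past : reach A (λ i → mark (u i) false) n ≡ reach A (markedAt mark u n) n
  unmarked-past = DFA.reach-prefix A n λ i<n → cong (mark _) (sym (natStream-≢ (<⇒≢ i<n)))

bitOf : ∀ {m} → Vec ℕ m → Vec Bool m → ℕ → Bool
bitOf []       []       v = false
bitOf (x ∷ xs) (b ∷ bs) v with v ≟ x
... | yes _ = b
... | no  _ = bitOf xs bs v

bitOf-∈ : ∀ {m} {xs : Vec ℕ m} {bs : Vec Bool m} {v} (f : ℕ → Bool) → v ∈ xs →
          (∀ i → lookup bs i ≡ f (lookup xs i)) → bitOf xs bs v ≡ f v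
bitOf-∈ {xs = x ∷ xs} {b ∷ bs} {v} f v∈ agree with v ≟ x
... | yes refl = agree fzero
... | no  v≢x with v∈
...   | here v≡x   = contradiction v≡x v≢x
...   | there v∈xs = bitOf-∈ f v∈xs (agree ∘ fsuc)

-- The Bool argument is the bit of z: it marks the current output position.
decode : ∀ {ℓ p} → IVar → Vec IVar ℓ → Vec PVar p → Vec Bool ℓ × Vec Bool p → Bool → Letter
decode z xs Xs (bs , cs) b = record { ind = bitOf xs bs [ z ≔ b ] ; pred = bitOf Xs cs }

module _ {ℓ p} (z : IVar) (xs : Vec IVar ℓ) (Xs : Vec PVar p) (ψ : Formula)
         (freeI : ∀ {v} → FreeI v ψ → v ≡ z ⊎ v ∈ xs) (freeP : ∀ {V} → FreeP V ψ → V ∈ Xs)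
         {n : ℕ} {σs : Vec (Stream Bool) p} {ks : Vec ℕ ℓ} (ks≤n : ∀ i → lookup ks i ≤ n)
         {ι : IEnv} {ρ : PEnv} (ιz≡n : ι z ≡ n) (ιxs≡ks : ∀ i → ι (lookup xs i) ≡ lookup ks i)
         (ρXs≡σs : ∀ j m → ρ (lookup Xs j) m ≡ lookup σs j m) where

  input-encodes : Encodes n (markedAt (decode z xs Xs) (encode ks σs) n) ι ρ ψ
  input-encodes = record { ind-bounded = bounded ; ind-marks = marks ; pred-marks = pmarks }
    where
    bounded : ∀ {v} → FreeI v ψ → ι v ≤ n
    bounded free with freeI free
    ... | inj₁ refl = ≤-reflexive ιz≡n
    ... | inj₂ v∈xs rewrite lookup-index v∈xs = subst (_≤ n) (sym (ιxs≡ks (Any.index v∈xs))) (ks≤n _)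
    marks : ∀ {v} → FreeI v ψ → ∀ {j} → j ≤ n → (bitOf xs (map (λ k → natStream k j) ks) [ z ≔ natStream n j ]) v ≡ natStream (ι v) j
    marks {v} free {j} _ = cases (v ≟ z)
      where
      cases : Dec (v ≡ z) → (bitOf xs (map (λ k → natStream k j) ks) [ z ≔ natStream n j ]) v ≡ natStream (ι v) j
      cases (yes refl) = trans ([≔]-≡ _ v _) (cong (λ k → natStream k j) (sym ιz≡n))
      cases (no  v≢z)  = trans ([≔]-≢ _ _ v≢z) (bitOf-∈ (λ v → natStream (ι v) j) v∈xs λ i →
                           trans (lookup-map i (λ k → natStream k j) ks) (cong (λ k → natStream k j) (sym (ιxs≡ks i))))
        where
        v∈xs : v ∈ xs
        v∈xs = [ (λ v≡z → contradiction v≡z v≢z) , id ] (freeI free)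
    pmarks : ∀ {V} → FreeP V ψ → ∀ {j} → j ≤ n → bitOf Xs (map (λ s → s j) σs) V ≡ ρ V j
    pmarks free {j} _ = bitOf-∈ (λ V → ρ V j) (freeP free) λ i →
                          trans (lookup-map i (λ s → s j) σs) (sym (ρXs≡σs i j))

lemma4p8 : ∀ {ℓ p} (z : IVar) (xs : Vec IVar ℓ) (Xs : Vec PVar p) (φ : Formula)
           → BoundedBy z φ
           → (∀ v → FreeI v φ → v ≡ z ⊎ v ∈ xs)
           → (∀ V → FreeP V φ → V ∈ Xs)
           → Σ (Mealy (Vec Bool ℓ × Vec Bool p) Bool) λ M →
               ∀ (n : ℕ) (σs : Vec (Stream Bool) p) (ks : Vec ℕ ℓ)
               → (∀ i → lookup ks i ≤ n)
               → ∀ (ι : IEnv) (ρ : PEnv)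
               → ι z ≡ n
               → (∀ i → ι (lookup xs i) ≡ lookup ks i)
               → (∀ j m → ρ (lookup Xs j) m ≡ lookup σs j m)
               → ((run M (encode ks σs) n ≡ true) ⇔ Sat ι ρ φ)
lemma4p8 z xs Xs .(relativize ψ (leA y z) y) (y , y≢z , ψ , z-unbound , refl) freeI freeP =
  M , λ { .(ι z) σs ks ks≤n ι ρ refl ιxs≡ks ρXs≡σs →
    ⇔-sym (Sat-relativize y≢z ψ z-unbound ι ρ)
      ⇔-∘ (automaton-represents ψ (input-encodes z xs Xs ψ freeIψ freePψ ks≤n refl ιxs≡ks ρXs≡σs)
      ⇔-∘ (T-cong (run-mealy (decode z xs Xs) (automaton ψ) (encode ks σs) (ι z)) ⇔-∘ ⇔-sym T-≡)) }
  where
  M = mealy (decode z xs Xs) (automaton ψ)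
  freeIψ : ∀ {v} → FreeI v ψ → v ≡ z ⊎ v ∈ xs
  freeIψ free = freeI _ (FreeI-relativize ψ (leA y z) y free)
  freePψ : ∀ {V} → FreeP V ψ → V ∈ Xs
  freePψ free = freeP _ (FreeP-relativize ψ (leA y z) y free)
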